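{- Let $C$ be a doubly even self-dual binary linear code of length $N$ with code-lattice $L$, and let $\bar g\in\operatorname{Aut}C$ have even order $m$; let $g=\iota(\bar g)\in\operatorname{Aut}L$. Then the standard lift $\hat g$ of $g$ to the lattice vertex operator algebra $V_L$ does not have order doubling (i.e. $\hat g$ has order $m$ rather than $2m$) if and only if $|B\cap\bar g^{m/2}(B)|\equiv0\pmod4$ for every codeword $B\in C$ (codewords viewed as subsets of $\{1,\dots,N\}$).
   Context: Code-lattice: with $\langle\beta_i,\beta_j\rangle=\tfrac12\delta_{ij}$, $L=\{\sum_ia_i\beta_i:a_i\in\mathbb{Z},(a_i\bmod2)_i\in C\}$; $\iota(\sigma)(\beta_j)=\beta_{\sigma(j)}$ (equivalently, with $\alpha_i=2\beta_i$ of norm $2$, $L$ is the union over $B\in C$ of $\tfrac12\sum_{i\in B}\alpha_i+\bigoplus_i\mathbb{Z}\alpha_i$). $V_L$ is the lattice vertex operator algebra built from the Heisenberg algebra of $L\otimes\mathbb{C}$ and a twisted group algebra $\mathbb{C}_\epsilon[L]$ with basis $\mathfrak e_\alpha$, $\mathfrak e_\alpha\mathfrak e_\beta=\epsilon(\alpha,\beta)\mathfrak e_{\alpha+\beta}$. A lift of $g\in\operatorname{Aut}L$ acts as $g$ on the Heisenberg part and by $\mathfrak e_\alpha\mapsto u(\alpha)\mathfrak e_{g\alpha}$, where $u:L\to\{\pm1\}$ satisfies $\epsilon(\alpha,\beta)/\epsilon(g\alpha,g\beta)=u(\alpha)u(\beta)/u(\alpha+\beta)$; it is standard if $u(\alpha)=1$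 for all $\alpha$ fixed by $g$. Order doubling means the lift has order twice the order of $g$. -}

module Defs where

open import Data.Bool using (Bool; true; false; _∧_; _xor_; if_then_else_)
open import Data.Nat using (ℕ; zero; suc; _+_; _*_; _%_; _<_; _≡ᵇ_)
open import Data.Integer as ℤ using (ℤ; ∣_∣)
open import Data.Fin using (Fin)
open import Data.Fin.Permutation using (Permutation′; _⟨$⟩ʳ_; _⟨$⟩ˡ_)
open import Data.Vec using (Vec; lookup; tabulate; map; zipWith; replicate; allFin; foldr)
open import Data.Product using (_×_; _,_)
open import Function.Bundles using (_⇔_)
open import Relation.Binary.PropositionalEquality using (_≡_)
open import Relation.Nullary using (¬_)

-- Binary codes.  A word of F₂^N is a Vec Bool N (equivalently a subset
-- of {1..N}, true = member); a code is a predicate on words.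

Word : ℕ → Set
Word N = Vec Bool N

Code : ℕ → Set₁
Code N = Word N → Set

countF : ∀ {N} → (Fin N → Bool) → ℕ
countF {N} f = foldr (λ _ → ℕ) (λ i acc → (if f i then 1 else 0) + acc) 0 (allFin N)

weight : ∀ {N} → Word N → ℕ
weight x = countF (λ i → lookup x i)

inter : ∀ {N} → Word N → Word N → ℕ
inter x y = countF (λ i → lookup x i ∧ lookup y i)

record LinearCode {N : ℕ} (C : Code N) : Set where
  field
    zero∈ : C (replicate N false)
    closed+ : ∀ x y → C x → C y → C (zipWith _xor_ x y)

SelfDual : ∀ {N} → Code N → Set
SelfDual {N} C = ∀ (x : Word N) → C x ⇔ (∀ c → C c → inter x c % 2 ≡ 0)

DoublyEven : ∀ {N} → Code N → Set
DoublyEven C = ∀ c → C c → weight c % 4 ≡ 0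

pow : ∀ {N} → Permutation′ N → ℕ → Fin N → Fin N
pow σ zero i = i
pow σ (suc k) i = σ ⟨$⟩ʳ pow σ k i

powInv : ∀ {N} → Permutation′ N → ℕ → Fin N → Fin N
powInv σ zero i = i
powInv σ (suc k) i = σ ⟨$⟩ˡ powInv σ k i

HasOrder : ∀ {N} → Permutation′ N → ℕ → Set
HasOrder σ m = (0 < m) × (∀ i → pow σ m i ≡ i)
             × (∀ k → 0 < k → k < m → ¬ (∀ i → pow σ k i ≡ i))

permWord : ∀ {N} → Permutation′ N → ℕ → Word N → Word N
permWord σ k B = tabulate (λ i → lookup B (powInv σ k i))

InAut : ∀ {N} → Code N → Permutation′ N → Set
InAut C σ = ∀ B → C B ⇔ C (permWord σ 1 B)

-- The code lattice L.  α = Σ a_i β_i is represented by its coordinate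
-- vector a ∈ ℤ^N;  α ∈ L iff (a_i mod 2)_i ∈ C.  ⟨β_i,β_j⟩ = δ_ij/2.

Vect : ℕ → Set
Vect N = Vec ℤ N

odd? : ℤ → Bool
odd? z = ∣ z ∣ % 2 ≡ᵇ 1

inL : ∀ {N} → Code N → Vect N → Set
inL C a = C (map odd? a)

_⊕_ : ∀ {N} → Vect N → Vect N → Vect N
a ⊕ b = zipWith ℤ._+_ a b

-- twice the inner product: 2⟨α,β⟩ = Σ a_i b_i
ip2 : ∀ {N} → Vect N → Vect N → ℤ
ip2 {N} a b = foldr (λ _ → ℤ) (λ i acc → lookup a i ℤ.* lookup b i ℤ.+ acc) (ℤ.+ 0) (allFin N)

-- signs ±1 are encoded as Bool (false = +1, true = -1; product = xor).
-- pairSign a b encodes (-1)^⟨α,β⟩ for α,β ∈ L (where 2⟨α,β⟩ is even).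
pairSign : ∀ {N} → Vect N → Vect N → Bool
pairSign a b = ∣ ip2 a b ∣ % 4 ≡ᵇ 2

-- ι(σ)^k (β_j) = β_{σ^k(j)}: coordinate at i becomes a_{σ^{-k} i}
actL : ∀ {N} → Permutation′ N → ℕ → Vect N → Vect N
actL σ k a = tabulate (λ i → lookup a (powInv σ k i))

record Cocycle {N : ℕ} (C : Code N) (ε : Vect N → Vect N → Bool) : Set where
  field
    bimulˡ : ∀ a b c → inL C a → inL C b → inL C c →
             ε (a ⊕ b) c ≡ ε a c xor ε b c
    bimulʳ : ∀ a b c → inL C a → inL C b → inL C c →
             ε a (b ⊕ c) ≡ ε a b xor ε a c
    comm   : ∀ a b → inL C a → inL C b → ε a b xor ε b a ≡ pairSign a b

-- u defines a lift 𝔢_α ↦ u(α) 𝔢_{gα} of g = ι(σ):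
-- ε(α,β)/ε(gα,gβ) = u(α)u(β)/u(α+β)
IsLift : ∀ {N} → Code N → (Vect N → Vect N → Bool) → Permutation′ N → (Vect N → Bool) → Set
IsLift C ε σ u = ∀ a b → inL C a → inL C b →
  ε a b xor ε (actL σ 1 a) (actL σ 1 b) ≡ u a xor u b xor u (a ⊕ b)

IsStandard : ∀ {N} → Code N → Permutation′ N → (Vect N → Bool) → Set
IsStandard C σ u = ∀ a → inL C a → actL σ 1 a ≡ a → u a ≡ false

-- action of the lift ĝ on the elements ±𝔢_α  (sign , α)
hatAct : ∀ {N} → Permutation′ N → (Vect N → Bool) → Bool × Vect N → Bool × Vect N
hatAct σ u (s , a) = (s xor u a , actL σ 1 a)

iter : ∀ {A : Set} → ℕ → (A → A) → A → A
iter zero f x = x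
iter (suc n) f x = f (iter n f x)

-- ĝ^m = id on V_L (ĝ^m is the identity on the Heisenberg part since
-- g^m = 1, so this amounts to ĝ^m 𝔢_α = 𝔢_α for all α ∈ L); given that
-- g has order m this says ĝ has order m, i.e. no order doubling.
NoOrderDoubling : ∀ {N} → Code N → Permutation′ N → (Vect N → Bool) → ℕ → Set
NoOrderDoubling C σ u m = ∀ a → inL C a → iter m (hatAct σ u) (false , a) ≡ (false , a)

{-# OPTIONS --safe #-}
module Submission where

-- Let g = ι(σ), h = gᵏ, and let cₙ(α) be the sign with ĝⁿ 𝔢_α = (−1)^cₙ(α) 𝔢_{gⁿα}. Lift
-- conditions compose, so cₙ satisfies the lift condition for gⁿ, and ĝ²ᵏ 𝔢_α = (−1)^c 𝔢_α with
-- c = cₖ(α) + cₖ(hα). Since h² = 1, the lift condition for h at (α, hα) turns c into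
-- ⟨α, hα⟩ + cₖ(y) with y = α + hα. As y is h-fixed, its orbit sum S = y + gy + ⋯ + gᵏ⁻¹y is
-- g-fixed, so the standard lift has u(S) = 1, and telescoping the lift condition along the
-- orbit gives cₖ(y) = ⟨S, y⟩ = 2⟨S, α⟩, which is even because L is integral. Thus ĝ²ᵏ = 1 iff
-- ⟨α, hα⟩ is even on L. Writing α = β_B + 2w, where β_B is the 0/1 vector of the codeword
-- B = α mod 2, one gets 2⟨α, hα⟩ ≡ |B ∩ σᵏ(B)| (mod 4): the two cross terms agree because h is
-- an involutive isometry.

open import Defs
open import Algebra.Properties.AbelianGroup using (∙-cancelˡ)
import Algebra.Properties.CommutativeMonoid.Sum as MonoidSum
open import Data.Bool using (Bool; true; false; not; _∧_; _xor_; if_then_else_)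
open import Data.Bool.Properties
  using (xor-∧-commutativeRing; xor-same; xor-comm; xor-assoc; xor-identityʳ; not-distribˡ-xor; xor-annihilates-not)
open import Data.Fin as Fin using (Fin)
open import Data.Fin.Permutation as Perm using (Permutation′; _⟨$⟩ʳ_; _⟨$⟩ˡ_)
open import Data.Integer as ℤ using (ℤ; +_; -[1+_]; _⊖_; ∣_∣; _+_; -_; _-_)
import Data.Integer.Properties as ℤP
open import Data.Integer.Tactic.RingSolver using (solve-∀)
open import Data.Maybe using (just; nothing)
open import Data.Nat as ℕ using (ℕ; zero; suc; _*_; _%_; _≡ᵇ_)
import Data.Nat.DivMod as ℕD
import Data.Nat.Properties as ℕP
open import Data.Product using (∃; _,_; proj₁; proj₂)
open import Data.Vec using (Vec; lookup; tabulate; map; zipWith; replicate; foldr)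
import Data.Vec.Functional as Vector
import Data.Vec.Properties as VecP
open import Function using (_∘_; id)
open import Function.Bundles using (_⇔_; mk⇔; Equivalence)
open import Function.Properties.Equivalence using () renaming (trans to ⇔-trans)
open import Level using (0ℓ)
open import Relation.Binary.PropositionalEquality
import Tactic.RingSolver.Core.AlmostCommutativeRing as ACR

open ≡-Reasoning
open MonoidSum ℤP.+-0-commutativeMonoid using (sum; sum-cong-≗; ∑-distrib-+; ∑-permute)

-- Coefficients are taken in Bool itself, so the ring solver normalises x xor x to false.
xor-∧-almostCommutativeRing : ACR.AlmostCommutativeRing 0ℓ 0ℓ
xor-∧-almostCommutativeRing =
  ACR.fromCommutativeRing xor-∧-commutativeRing λ { false → just refl ; true → nothing }

open import Tactic.RingSolver.NonReflective xor-∧-almostCommutativeRing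
  using (solve; _⊜_) renaming (_⊕_ to _⊻_)

xor-telescope : ∀ x y z → x xor z ≡ (x xor y) xor (y xor z)
xor-telescope = solve 3 (λ x y z → (x ⊻ z) ⊜ ((x ⊻ y) ⊻ (y ⊻ z))) refl

xor-interchange₃ : ∀ p q r p′ q′ r′ →
  (p xor q xor r) xor (p′ xor q′ xor r′) ≡ (p xor p′) xor (q xor q′) xor (r xor r′)
xor-interchange₃ = solve 6
  (λ p q r p′ q′ r′ → ((p ⊻ (q ⊻ r)) ⊻ (p′ ⊻ (q′ ⊻ r′))) ⊜ ((p ⊻ p′) ⊻ ((q ⊻ q′) ⊻ (r ⊻ r′))))
  refl

-- odd? z unfolds to odd ∣ z ∣, which the proofs below use silently.
odd : ℕ → Bool
odd n = n % 2 ≡ᵇ 1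

odd-suc : ∀ n → odd (suc n) ≡ not (odd n)
odd-suc 0 = refl
odd-suc 1 = refl
odd-suc (suc (suc n)) = odd-suc n

odd-+ : ∀ m n → odd (m ℕ.+ n) ≡ odd m xor odd n
odd-+ zero n = refl
odd-+ (suc m) n = begin
  odd (suc (m ℕ.+ n))    ≡⟨ odd-suc (m ℕ.+ n) ⟩
  not (odd (m ℕ.+ n))    ≡⟨ cong not (odd-+ m n) ⟩
  not (odd m xor odd n)  ≡⟨ not-distribˡ-xor (odd m) (odd n) ⟩
  not (odd m) xor odd n  ≡⟨ cong (_xor odd n) (odd-suc m) ⟨
  odd (suc m) xor odd n  ∎

odd-∣⊖∣ : ∀ m n → odd ∣ m ⊖ n ∣ ≡ odd m xor odd n
odd-∣⊖∣ zero zero = refl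
odd-∣⊖∣ zero (suc n) = refl
odd-∣⊖∣ (suc m) zero = sym (xor-identityʳ (odd (suc m)))
odd-∣⊖∣ (suc m) (suc n) = begin
  odd ∣ suc m ⊖ suc n ∣        ≡⟨ cong (odd ∘ ∣_∣) (ℤP.[1+m]⊖[1+n]≡m⊖n m n) ⟩
  odd ∣ m ⊖ n ∣                ≡⟨ odd-∣⊖∣ m n ⟩
  odd m xor odd n              ≡⟨ xor-annihilates-not (odd m) (odd n) ⟨
  not (odd m) xor not (odd n)  ≡⟨ cong₂ _xor_ (odd-suc m) (odd-suc n) ⟨
  odd (suc m) xor odd (suc n)  ∎

odd?-+ : ∀ i j → odd? (i + j) ≡ odd? i xor odd? j
odd?-+ (+ m) (+ n) = odd-+ m n
odd?-+ (+ m) -[1+ n ] = odd-∣⊖∣ m (suc n)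
odd?-+ -[1+ m ] (+ n) = trans (odd-∣⊖∣ n (suc m)) (xor-comm (odd n) (odd (suc m)))
odd?-+ -[1+ m ] -[1+ n ] = begin
  odd (suc (suc (m ℕ.+ n)))    ≡⟨ cong (odd ∘ suc) (ℕP.+-suc m n) ⟨
  odd (suc m ℕ.+ suc n)        ≡⟨ odd-+ (suc m) (suc n) ⟩
  odd (suc m) xor odd (suc n)  ∎

odd?-+-double : ∀ i j → odd? (i + (j + j)) ≡ odd? i
odd?-+-double i j = begin
  odd? (i + (j + j))             ≡⟨ odd?-+ i (j + j) ⟩
  odd? i xor odd? (j + j)        ≡⟨ cong (odd? i xor_) (odd?-+ j j) ⟩
  odd? i xor (odd? j xor odd? j) ≡⟨ cong (odd? i xor_) (xor-same (odd? j)) ⟩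
  odd? i xor false               ≡⟨ xor-identityʳ (odd? i) ⟩
  odd? i                         ∎

bit : Bool → ℤ
bit false = + 0
bit true = + 1

odd?-bit : ∀ b → odd? (bit b) ≡ b
odd?-bit false = refl
odd?-bit true = refl

bit-∧ : ∀ x y → bit x ℤ.* bit y ≡ bit (x ∧ y)
bit-∧ false y = refl
bit-∧ true false = refl
bit-∧ true true = refl

+-parity-split : ∀ n → ∃ λ w → + n ≡ bit (odd n) + (w + w)
+-parity-split 0 = + 0 , refl
+-parity-split 1 = + 0 , refl
+-parity-split (suc (suc n)) with +-parity-split n
... | w , eq = w + + 1 , (begin
  + 2 + + n                          ≡⟨ cong (λ t → + 2 + t) eq ⟩
  + 2 + (bit (odd n) + (w + w))      ≡⟨ shift (bit (odd n)) w ⟩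
  bit (odd n) + ((w + + 1) + (w + + 1)) ∎)
  where
  shift : ∀ b w → + 2 + (b + (w + w)) ≡ b + ((w + + 1) + (w + + 1))
  shift = solve-∀

parity-split : ∀ z → ∃ λ w → z ≡ bit (odd? z) + (w + w)
parity-split (+ n) = +-parity-split n
parity-split -[1+ n ] with +-parity-split (suc n)
... | w , eq = - w - b , (begin
  - (+ suc n)                    ≡⟨ cong -_ eq ⟩
  - (b + (w + w))                ≡⟨ negate b w ⟩
  b + ((- w - b) + (- w - b))    ∎)
  where
  b = bit (odd (suc n))
  negate : ∀ b w → - (b + (w + w)) ≡ b + ((- w - b) + (- w - b))
  negate = solve-∀

even⇒double : ∀ z → odd? z ≡ false → ∃ λ w → z ≡ w + w
even⇒double z even with parity-split z
... | w , eq = w , trans eq (trans (cong (λ b → bit b + (w + w)) even) (ℤP.+-identityˡ (w + w)))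

∣4*w∣%4≡0 : ∀ w → ∣ + 4 ℤ.* w ∣ % 4 ≡ 0
∣4*w∣%4≡0 w = begin
  ∣ + 4 ℤ.* w ∣ % 4   ≡⟨ cong (_% 4) (ℤP.∣i*j∣≡∣i∣*∣j∣ (+ 4) w) ⟩
  (4 * ∣ w ∣) % 4     ≡⟨ cong (_% 4) (ℕP.*-comm 4 ∣ w ∣) ⟩
  (∣ w ∣ * 4) % 4     ≡⟨ ℕD.m*n%n≡0 ∣ w ∣ 4 ⟩
  0                   ∎

-- (4 + n) % 4 and (4 + n) % 2 reduce to n % 4 and n % 2, so the recursive clause typechecks.
even∧%4≢2⇒%4≡0 : ∀ n → n % 2 ≡ 0 → (n % 4 ≡ᵇ 2) ≡ false → n % 4 ≡ 0
even∧%4≢2⇒%4≡0 0 _ _ = refl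
even∧%4≢2⇒%4≡0 1 () _
even∧%4≢2⇒%4≡0 2 _ ()
even∧%4≢2⇒%4≡0 3 () _
even∧%4≢2⇒%4≡0 (suc (suc (suc (suc n)))) = even∧%4≢2⇒%4≡0 n

lookup-ext : ∀ {A : Set} {n} {x y : Vec A n} → (∀ i → lookup x i ≡ lookup y i) → x ≡ y
lookup-ext {x = x} {y} eq = begin
  x                  ≡⟨ VecP.tabulate∘lookup x ⟨
  tabulate (lookup x) ≡⟨ VecP.tabulate-cong eq ⟩
  tabulate (lookup y) ≡⟨ VecP.tabulate∘lookup y ⟩
  y                  ∎

map-reindex : ∀ {A B : Set} {n} (f : A → B) (π : Fin n → Fin n) (v : Vec A n) →
  map f (tabulate (lookup v ∘ π)) ≡ tabulate (lookup (map f v) ∘ π)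
map-reindex f π v = begin
  map f (tabulate (lookup v ∘ π))   ≡⟨ VecP.tabulate-∘ f (lookup v ∘ π) ⟨
  tabulate (f ∘ lookup v ∘ π)       ≡⟨ VecP.tabulate-cong (λ i → VecP.lookup-map (π i) f v) ⟨
  tabulate (lookup (map f v) ∘ π)   ∎

foldr-tabulate : ∀ {A : Set} {m n} (_∙_ : A → A → A) (e : A) (f : Fin n → A) (h : Fin m → Fin n) →
  foldr (λ _ → A) (λ i acc → f i ∙ acc) e (tabulate h) ≡ Vector.foldr _∙_ e (f ∘ h)
foldr-tabulate {m = zero} _∙_ e f h = refl
foldr-tabulate {m = suc m} _∙_ e f h = cong (f (h Fin.zero) ∙_) (foldr-tabulate _∙_ e f (h ∘ Fin.suc))

module _ {N : ℕ} where

  0ᵛ : Vect N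
  0ᵛ = replicate N (+ 0)

  embed : Word N → Vect N
  embed = map bit

  lookup-⊕ : ∀ (a b : Vect N) i → lookup (a ⊕ b) i ≡ lookup a i + lookup b i
  lookup-⊕ a b i = VecP.lookup-zipWith _+_ i a b

  ⊕-comm : ∀ (a b : Vect N) → a ⊕ b ≡ b ⊕ a
  ⊕-comm = VecP.zipWith-comm ℤP.+-comm

  ⊕-assoc : ∀ (a b c : Vect N) → (a ⊕ b) ⊕ c ≡ a ⊕ (b ⊕ c)
  ⊕-assoc = VecP.zipWith-assoc ℤP.+-assoc

  ⊕-identityˡ : ∀ (a : Vect N) → 0ᵛ ⊕ a ≡ a
  ⊕-identityˡ = VecP.zipWith-identityˡ ℤP.+-identityˡ

  ⊕-identityʳ : ∀ (a : Vect N) → a ⊕ 0ᵛ ≡ a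
  ⊕-identityʳ = VecP.zipWith-identityʳ ℤP.+-identityʳ

  ⊕-cancelˡ : ∀ (a b c : Vect N) → a ⊕ b ≡ a ⊕ c → b ≡ c
  ⊕-cancelˡ a b c eq = lookup-ext λ i → ∙-cancelˡ ℤP.+-0-abelianGroup (lookup a i) _ _
    (trans (sym (lookup-⊕ a b i)) (trans (cong (λ v → lookup v i) eq) (lookup-⊕ a c i)))

  map-odd?-⊕ : ∀ (a b : Vect N) → map odd? (a ⊕ b) ≡ zipWith _xor_ (map odd? a) (map odd? b)
  map-odd?-⊕ a b = lookup-ext λ i → begin
    lookup (map odd? (a ⊕ b)) i                       ≡⟨ VecP.lookup-map i odd? (a ⊕ b) ⟩
    odd? (lookup (a ⊕ b) i)                           ≡⟨ cong odd? (lookup-⊕ a b i) ⟩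
    odd? (lookup a i + lookup b i)                    ≡⟨ odd?-+ (lookup a i) (lookup b i) ⟩
    odd? (lookup a i) xor odd? (lookup b i)           ≡⟨ cong₂ _xor_ (VecP.lookup-map i odd? a) (VecP.lookup-map i odd? b) ⟨
    lookup (map odd? a) i xor lookup (map odd? b) i   ≡⟨ VecP.lookup-zipWith _xor_ i (map odd? a) (map odd? b) ⟨
    lookup (zipWith _xor_ (map odd? a) (map odd? b)) i ∎

  map-odd?-0ᵛ : map odd? 0ᵛ ≡ replicate N false
  map-odd?-0ᵛ = VecP.map-replicate odd? (+ 0) N

  map-odd?-embed : ∀ (B : Word N) → map odd? (embed B) ≡ B
  map-odd?-embed B = begin
    map odd? (map bit B) ≡⟨ VecP.map-∘ odd? bit B ⟨
    map (odd? ∘ bit) B   ≡⟨ VecP.map-cong odd?-bit B ⟩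
    map id B             ≡⟨ VecP.map-id B ⟩
    B                    ∎

  parity-split-vec : ∀ (a : Vect N) → ∃ λ w → a ≡ embed (map odd? a) ⊕ (w ⊕ w)
  parity-split-vec a = w , lookup-ext λ i → begin
    lookup a i                                            ≡⟨ proj₂ (parity-split (lookup a i)) ⟩
    bit (odd? (lookup a i)) + (wᵢ i + wᵢ i)               ≡⟨ cong₂ _+_ (lookup-embed i) (sym (lookup-double i)) ⟩
    lookup (embed (map odd? a)) i + lookup (w ⊕ w) i      ≡⟨ lookup-⊕ (embed (map odd? a)) (w ⊕ w) i ⟨
    lookup (embed (map odd? a) ⊕ (w ⊕ w)) i               ∎
    where
    wᵢ : Fin N → ℤ
    wᵢ i = proj₁ (parity-split (lookup a i))
    w = tabulate wᵢ
    lookup-embed : ∀ i → bit (odd? (lookup a i)) ≡ lookup (embed (map odd? a)) i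
    lookup-embed i = sym (trans (VecP.lookup-map i bit (map odd? a)) (cong bit (VecP.lookup-map i odd? a)))
    lookup-double : ∀ i → lookup (w ⊕ w) i ≡ wᵢ i + wᵢ i
    lookup-double i = trans (lookup-⊕ w w i) (cong₂ _+_ (VecP.lookup∘tabulate wᵢ i) (VecP.lookup∘tabulate wᵢ i))

  ip2≡∑ : ∀ (a b : Vect N) → ip2 a b ≡ sum (λ i → lookup a i ℤ.* lookup b i)
  ip2≡∑ a b = foldr-tabulate _+_ (+ 0) (λ i → lookup a i ℤ.* lookup b i) id

  ip2-comm : ∀ (a b : Vect N) → ip2 a b ≡ ip2 b a
  ip2-comm a b = begin
    ip2 a b                                ≡⟨ ip2≡∑ a b ⟩
    sum (λ i → lookup a i ℤ.* lookup b i)  ≡⟨ sum-cong-≗ (λ i → ℤP.*-comm (lookup a i) (lookup b i)) ⟩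
    sum (λ i → lookup b i ℤ.* lookup a i)  ≡⟨ ip2≡∑ b a ⟨
    ip2 b a                                ∎

  ip2-⊕ˡ : ∀ (a b c : Vect N) → ip2 (a ⊕ b) c ≡ ip2 a c + ip2 b c
  ip2-⊕ˡ a b c = begin
    ip2 (a ⊕ b) c                                    ≡⟨ ip2≡∑ (a ⊕ b) c ⟩
    sum (λ i → lookup (a ⊕ b) i ℤ.* lookup c i)      ≡⟨ sum-cong-≗ distrib ⟩
    sum (λ i → lookup a i ℤ.* lookup c i + lookup b i ℤ.* lookup c i)
                                                     ≡⟨ ∑-distrib-+ (λ i → lookup a i ℤ.* lookup c i) (λ i → lookup b i ℤ.* lookup c i) ⟩
    sum (λ i → lookup a i ℤ.* lookup c i) + sum (λ i → lookup b i ℤ.* lookup c i)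
                                                     ≡⟨ cong₂ _+_ (ip2≡∑ a c) (ip2≡∑ b c) ⟨
    ip2 a c + ip2 b c                                ∎
    where
    distrib : ∀ i → lookup (a ⊕ b) i ℤ.* lookup c i ≡ lookup a i ℤ.* lookup c i + lookup b i ℤ.* lookup c i
    distrib i = trans (cong (ℤ._* lookup c i) (lookup-⊕ a b i)) (ℤP.*-distribʳ-+ (lookup c i) (lookup a i) (lookup b i))

  ip2-⊕ʳ : ∀ (a b c : Vect N) → ip2 a (b ⊕ c) ≡ ip2 a b + ip2 a c
  ip2-⊕ʳ a b c = begin
    ip2 a (b ⊕ c)      ≡⟨ ip2-comm a (b ⊕ c) ⟩
    ip2 (b ⊕ c) a      ≡⟨ ip2-⊕ˡ b c a ⟩
    ip2 b a + ip2 c a  ≡⟨ cong₂ _+_ (ip2-comm b a) (ip2-comm c a) ⟩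
    ip2 a b + ip2 a c  ∎

  ip2-embed : ∀ (A B : Word N) → ip2 (embed A) (embed B) ≡ + inter A B
  ip2-embed A B = begin
    ip2 (embed A) (embed B)                             ≡⟨ ip2≡∑ (embed A) (embed B) ⟩
    sum (λ i → lookup (embed A) i ℤ.* lookup (embed B) i) ≡⟨ sum-cong-≗ pointwise ⟩
    sum (λ i → bit (lookup A i ∧ lookup B i))           ≡⟨ sum-bit (λ i → lookup A i ∧ lookup B i) ⟨
    + countF (λ i → lookup A i ∧ lookup B i)            ∎
    where
    pointwise : ∀ i → lookup (embed A) i ℤ.* lookup (embed B) i ≡ bit (lookup A i ∧ lookup B i)
    pointwise i = trans (cong₂ ℤ._*_ (VecP.lookup-map i bit A) (VecP.lookup-map i bit B)) (bit-∧ (lookup A i) (lookup B i))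
    sum-bit : ∀ {n} (f : Fin n → Bool) → + countF f ≡ sum (bit ∘ f)
    sum-bit {n} f = begin
      + countF f                                          ≡⟨ cong +_ (foldr-tabulate ℕ._+_ 0 (λ i → if f i then 1 else 0) id) ⟩
      + Vector.foldr ℕ._+_ 0 (λ i → if f i then 1 else 0) ≡⟨ pos-foldr f ⟩
      sum (bit ∘ f)                                       ∎
      where
      pos-foldr : ∀ {m} (h : Fin m → Bool) → + Vector.foldr ℕ._+_ 0 (λ i → if h i then 1 else 0) ≡ sum (bit ∘ h)
      pos-foldr {zero} h = refl
      pos-foldr {suc m} h with h Fin.zero
      ... | false = trans (pos-foldr (h ∘ Fin.suc)) (sym (ℤP.+-identityˡ _))
      ... | true = cong (_+_ (+ 1)) (pos-foldr (h ∘ Fin.suc))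

  ip2-expand : ∀ (b w b′ w′ : Vect N) →
    ip2 (b ⊕ (w ⊕ w)) (b′ ⊕ (w′ ⊕ w′))
      ≡ ip2 b b′ + ((ip2 b w′ + ip2 w b′ + (ip2 w w′ + ip2 w w′)) + (ip2 b w′ + ip2 w b′ + (ip2 w w′ + ip2 w w′)))
  ip2-expand b w b′ w′ = begin
    ip2 (b ⊕ (w ⊕ w)) c                     ≡⟨ ip2-⊕ˡ b (w ⊕ w) c ⟩
    ip2 b c + ip2 (w ⊕ w) c                 ≡⟨ cong (_+_ (ip2 b c)) (ip2-⊕ˡ w w c) ⟩
    ip2 b c + (ip2 w c + ip2 w c)           ≡⟨ cong₂ (λ s t → s + (t + t)) (expandʳ b) (expandʳ w) ⟩
    (ip2 b b′ + (ip2 b w′ + ip2 b w′)) + ((ip2 w b′ + (ip2 w w′ + ip2 w w′)) + (ip2 w b′ + (ip2 w w′ + ip2 w w′)))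
                                            ≡⟨ regroup (ip2 b b′) (ip2 b w′) (ip2 w b′) (ip2 w w′) ⟩
    _                                       ∎
    where
    c = b′ ⊕ (w′ ⊕ w′)
    expandʳ : ∀ x → ip2 x c ≡ ip2 x b′ + (ip2 x w′ + ip2 x w′)
    expandʳ x = trans (ip2-⊕ʳ x b′ (w′ ⊕ w′)) (cong (_+_ (ip2 x b′)) (ip2-⊕ʳ x w′ w′))
    regroup : ∀ B X Y Z → (B + (X + X)) + ((Y + (Z + Z)) + (Y + (Z + Z))) ≡ B + ((X + Y + (Z + Z)) + (X + Y + (Z + Z)))
    regroup = solve-∀

  odd?-ip2 : ∀ (a b : Vect N) → odd? (ip2 a b) ≡ odd (inter (map odd? a) (map odd? b))
  odd?-ip2 a b = begin
    odd? (ip2 a b)                                           ≡⟨ cong odd? (cong₂ ip2 (proj₂ (parity-split-vec a)) (proj₂ (parity-split-vec b))) ⟩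
    odd? (ip2 (embed A ⊕ (w ⊕ w)) (embed B ⊕ (v ⊕ v)))       ≡⟨ cong odd? (ip2-expand (embed A) w (embed B) v) ⟩
    odd? (ip2 (embed A) (embed B) + (t + t))                 ≡⟨ odd?-+-double (ip2 (embed A) (embed B)) t ⟩
    odd? (ip2 (embed A) (embed B))                           ≡⟨ cong odd? (ip2-embed A B) ⟩
    odd (inter A B)                                          ∎
    where
    A = map odd? a
    B = map odd? b
    w = proj₁ (parity-split-vec a)
    v = proj₁ (parity-split-vec b)
    t = ip2 (embed A) v + ip2 w (embed B) + (ip2 w v + ip2 w v)

  pairSign-false : ∀ (a b : Vect N) w → ip2 a b ≡ + 4 ℤ.* w → pairSign a b ≡ false
  pairSign-false a b w eq = trans (cong (λ z → ∣ z ∣ % 4 ≡ᵇ 2) eq) (cong (_≡ᵇ 2) (∣4*w∣%4≡0 w))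

module _ {A : Set} (f : A → A) where

  iter-+ : ∀ m n x → iter m f (iter n f x) ≡ iter (m ℕ.+ n) f x
  iter-+ zero n x = refl
  iter-+ (suc m) n x = cong f (iter-+ m n x)

  iter-fixed : ∀ {x} → f x ≡ x → ∀ n → iter n f x ≡ x
  iter-fixed fx≡x zero = refl
  iter-fixed fx≡x (suc n) = trans (cong f (iter-fixed fx≡x n)) fx≡x

  iter-preserves : (P : A → Set) → (∀ {x} → P x → P (f x)) → ∀ n {x} → P x → P (iter n f x)
  iter-preserves P pres zero px = px
  iter-preserves P pres (suc n) px = pres (iter-preserves P pres n px)

  iter-homo₂ : (_∙_ : A → A → A) → (∀ x y → f (x ∙ y) ≡ f x ∙ f y) →
    ∀ n x y → iter n f (x ∙ y) ≡ iter n f x ∙ iter n f y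
  iter-homo₂ _∙_ homo zero x y = refl
  iter-homo₂ _∙_ homo (suc n) x y = trans (cong f (iter-homo₂ _∙_ homo n x y)) (homo _ _)

  iter-invariant₂ : {B : Set} (F : A → A → B) → (∀ x y → F (f x) (f y) ≡ F x y) →
    ∀ n x y → F (iter n f x) (iter n f y) ≡ F x y
  iter-invariant₂ F inv zero x y = refl
  iter-invariant₂ F inv (suc n) x y = trans (inv _ _) (iter-invariant₂ F inv n x y)

2*k≡k+k : ∀ k → 2 * k ≡ k ℕ.+ k
2*k≡k+k k = cong (k ℕ.+_) (ℕP.+-identityʳ k)

ι : ∀ {N} → Permutation′ N → Vect N → Vect N
ι σ = actL σ 1

module _ {N : ℕ} (σ : Permutation′ N) where

  lookup-ι : ∀ (a : Vect N) i → lookup (ι σ a) i ≡ lookup a (σ ⟨$⟩ˡ i)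
  lookup-ι a i = VecP.lookup∘tabulate (λ j → lookup a (σ ⟨$⟩ˡ j)) i

  powInv-comm : ∀ n i → powInv σ n (σ ⟨$⟩ˡ i) ≡ σ ⟨$⟩ˡ powInv σ n i
  powInv-comm zero i = refl
  powInv-comm (suc n) i = cong (σ ⟨$⟩ˡ_) (powInv-comm n i)

  powInv-pow : ∀ n i → powInv σ n (pow σ n i) ≡ i
  powInv-pow zero i = refl
  powInv-pow (suc n) i = begin
    σ ⟨$⟩ˡ powInv σ n (σ ⟨$⟩ʳ pow σ n i)  ≡⟨ powInv-comm n (σ ⟨$⟩ʳ pow σ n i) ⟨
    powInv σ n (σ ⟨$⟩ˡ (σ ⟨$⟩ʳ pow σ n i)) ≡⟨ cong (powInv σ n) (Perm.inverseˡ σ) ⟩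
    powInv σ n (pow σ n i)                 ≡⟨ powInv-pow n i ⟩
    i                                      ∎

  iter-ι : ∀ n (a : Vect N) → iter n (ι σ) a ≡ actL σ n a
  iter-ι zero a = sym (VecP.tabulate∘lookup a)
  iter-ι (suc n) a = trans (cong (ι σ) (iter-ι n a)) (VecP.tabulate-cong λ i →
    trans (VecP.lookup∘tabulate (lookup a ∘ powInv σ n) (σ ⟨$⟩ˡ i)) (cong (lookup a) (powInv-comm n i)))

  iter-ι-id : ∀ m → (∀ i → pow σ m i ≡ i) → ∀ (a : Vect N) → iter m (ι σ) a ≡ a
  iter-ι-id m σᵐ≡id a = begin
    iter m (ι σ) a                         ≡⟨ iter-ι m a ⟩
    tabulate (lookup a ∘ powInv σ m)       ≡⟨ VecP.tabulate-cong (λ i → cong (lookup a) powInvᵐ≡id) ⟩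
    tabulate (lookup a)                    ≡⟨ VecP.tabulate∘lookup a ⟩
    a                                      ∎
    where
    powInvᵐ≡id : ∀ {i} → powInv σ m i ≡ i
    powInvᵐ≡id {i} = trans (cong (powInv σ m) (sym (σᵐ≡id i))) (powInv-pow m i)

  iter-ι-half-period : ∀ k → (∀ i → pow σ (2 * k) i ≡ i) → ∀ (a : Vect N) →
    iter k (ι σ) (iter k (ι σ) a) ≡ a
  iter-ι-half-period k σ²ᵏ≡id a = begin
    iter k (ι σ) (iter k (ι σ) a)  ≡⟨ iter-+ (ι σ) k k a ⟩
    iter (k ℕ.+ k) (ι σ) a         ≡⟨ cong (λ m → iter m (ι σ) a) (2*k≡k+k k) ⟨
    iter (2 * k) (ι σ) a           ≡⟨ iter-ι-id (2 * k) σ²ᵏ≡id a ⟩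
    a                              ∎

  ι-⊕ : ∀ (a b : Vect N) → ι σ (a ⊕ b) ≡ ι σ a ⊕ ι σ b
  ι-⊕ a b = lookup-ext λ i → begin
    lookup (ι σ (a ⊕ b)) i                   ≡⟨ lookup-ι (a ⊕ b) i ⟩
    lookup (a ⊕ b) (σ ⟨$⟩ˡ i)                ≡⟨ lookup-⊕ a b (σ ⟨$⟩ˡ i) ⟩
    lookup a (σ ⟨$⟩ˡ i) + lookup b (σ ⟨$⟩ˡ i) ≡⟨ cong₂ _+_ (lookup-ι a i) (lookup-ι b i) ⟨
    lookup (ι σ a) i + lookup (ι σ b) i      ≡⟨ lookup-⊕ (ι σ a) (ι σ b) i ⟨
    lookup (ι σ a ⊕ ι σ b) i                 ∎

  ι-0ᵛ : ι σ 0ᵛ ≡ 0ᵛ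
  ι-0ᵛ = lookup-ext λ i → trans (lookup-ι 0ᵛ i)
    (trans (VecP.lookup-replicate (σ ⟨$⟩ˡ i) (+ 0)) (sym (VecP.lookup-replicate i (+ 0))))

  ip2-ι : ∀ (a b : Vect N) → ip2 (ι σ a) (ι σ b) ≡ ip2 a b
  ip2-ι a b = begin
    ip2 (ι σ a) (ι σ b)                          ≡⟨ ip2≡∑ (ι σ a) (ι σ b) ⟩
    sum (λ i → lookup (ι σ a) i ℤ.* lookup (ι σ b) i)
                                                 ≡⟨ sum-cong-≗ (λ i → cong₂ ℤ._*_ (lookup-ι a i) (lookup-ι b i)) ⟩
    sum (λ i → product (σ ⟨$⟩ˡ i))               ≡⟨ ∑-permute product (Perm.flip σ) ⟨
    sum product                                  ≡⟨ ip2≡∑ a b ⟨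
    ip2 a b                                      ∎
    where
    product : Fin N → ℤ
    product j = lookup a j ℤ.* lookup b j

  map-odd?-ι : ∀ (a : Vect N) → map odd? (ι σ a) ≡ permWord σ 1 (map odd? a)
  map-odd?-ι a = map-reindex odd? (powInv σ 1) a

  iter-ι-embed : ∀ n (B : Word N) → iter n (ι σ) (embed B) ≡ embed (permWord σ n B)
  iter-ι-embed n B = trans (iter-ι n (embed B)) (sym (map-reindex bit (powInv σ n) B))

-- The code lattice

module Lattice {N : ℕ} {C : Code N} (lin : LinearCode C) where

  inL-⊕ : ∀ {a b : Vect N} → inL C a → inL C b → inL C (a ⊕ b)
  inL-⊕ {a} {b} p q = subst C (sym (map-odd?-⊕ a b)) (LinearCode.closed+ lin _ _ p q)

  inL-0ᵛ : inL C 0ᵛ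
  inL-0ᵛ = subst C (sym map-odd?-0ᵛ) (LinearCode.zero∈ lin)

  inL-embed : ∀ {B} → C B → inL C (embed B)
  inL-embed {B} = subst C (sym (map-odd?-embed B))

  inL-ι : ∀ σ → InAut C σ → ∀ {a} → inL C a → inL C (ι σ a)
  inL-ι σ aut {a} p = subst C (sym (map-odd?-ι σ a)) (Equivalence.to (aut (map odd? a)) p)

module _ {N : ℕ} {C : Code N} (sd : SelfDual C) where

  ip2-even : ∀ {a b : Vect N} → inL C a → inL C b → odd? (ip2 a b) ≡ false
  ip2-even {a} {b} p q = trans (odd?-ip2 a b) (cong (_≡ᵇ 1) (Equivalence.to (sd (map odd? a)) p (map odd? b) q))

  pairSign-trace : ∀ (σ : Permutation′ N) n {t a : Vect N} → inL C t → inL C a →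
    iter n (ι σ) t ≡ t → pairSign t (a ⊕ iter n (ι σ) a) ≡ false
  pairSign-trace σ n {t} {a} pt pa fixed with even⇒double (ip2 t a) (ip2-even pt pa)
  ... | w , ip2≡2w = pairSign-false t (a ⊕ h a) w (begin
    ip2 t (a ⊕ h a)           ≡⟨ ip2-⊕ʳ t a (h a) ⟩
    ip2 t a + ip2 t (h a)     ≡⟨ cong (λ s → ip2 t a + ip2 s (h a)) fixed ⟨
    ip2 t a + ip2 (h t) (h a) ≡⟨ cong (_+_ (ip2 t a)) (iter-invariant₂ (ι σ) ip2 (ip2-ι σ) n t a) ⟩
    ip2 t a + ip2 t a         ≡⟨ cong₂ _+_ ip2≡2w ip2≡2w ⟩
    (w + w) + (w + w)         ≡⟨ quadruple w ⟩
    + 4 ℤ.* w                 ∎)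
    where
    h = iter n (ι σ)
    quadruple : ∀ w → (w + w) + (w + w) ≡ + 4 ℤ.* w
    quadruple = solve-∀

-- Lifts to the twisted group algebra

module Lifts {N : ℕ} {C : Code N} (lin : LinearCode C)
    {ε : Vect N → Vect N → Bool} (coc : Cocycle C ε) where

  open Lattice lin
  open Cocycle coc

  -- IsLift C ε σ u is LiftOf (ι σ) u by definition.
  LiftOf : (Vect N → Vect N) → (Vect N → Bool) → Set
  LiftOf f w = ∀ a b → inL C a → inL C b → ε a b xor ε (f a) (f b) ≡ w a xor w b xor w (a ⊕ b)

  lift-id : LiftOf id (λ _ → false)
  lift-id a b _ _ = xor-same (ε a b)

  lift-∘ : ∀ {f h w v} → (∀ a b → f (a ⊕ b) ≡ f a ⊕ f b) → (∀ {a} → inL C a → inL C (f a)) →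
    LiftOf f w → LiftOf h v → LiftOf (h ∘ f) (λ a → w a xor v (f a))
  lift-∘ {f} {h} {w} {v} f-⊕ f-inL f-lift h-lift a b p q = begin
    ε a b xor ε (h (f a)) (h (f b))
      ≡⟨ xor-telescope (ε a b) (ε (f a) (f b)) _ ⟩
    (ε a b xor ε (f a) (f b)) xor (ε (f a) (f b) xor ε (h (f a)) (h (f b)))
      ≡⟨ cong₂ _xor_ (f-lift a b p q) (h-lift (f a) (f b) (f-inL p) (f-inL q)) ⟩
    (w a xor w b xor w (a ⊕ b)) xor (v (f a) xor v (f b) xor v (f a ⊕ f b))
      ≡⟨ cong (λ c → (w a xor w b xor w (a ⊕ b)) xor (v (f a) xor v (f b) xor v c)) (f-⊕ a b) ⟨
    (w a xor w b xor w (a ⊕ b)) xor (v (f a) xor v (f b) xor v (f (a ⊕ b)))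
      ≡⟨ xor-interchange₃ (w a) (w b) (w (a ⊕ b)) (v (f a)) (v (f b)) (v (f (a ⊕ b))) ⟩
    (w a xor v (f a)) xor (w b xor v (f b)) xor (w (a ⊕ b) xor v (f (a ⊕ b)))
      ∎

  ε-0ᵛˡ : ∀ {c} → inL C c → ε 0ᵛ c ≡ false
  ε-0ᵛˡ {c} p = begin
    ε 0ᵛ c                ≡⟨ cong (λ z → ε z c) (⊕-identityˡ 0ᵛ) ⟨
    ε (0ᵛ ⊕ 0ᵛ) c         ≡⟨ bimulˡ 0ᵛ 0ᵛ c inL-0ᵛ inL-0ᵛ p ⟩
    ε 0ᵛ c xor ε 0ᵛ c     ≡⟨ xor-same (ε 0ᵛ c) ⟩
    false                 ∎

  ε-0ᵛʳ : ∀ {c} → inL C c → ε c 0ᵛ ≡ false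
  ε-0ᵛʳ {c} p = begin
    ε c 0ᵛ                ≡⟨ cong (ε c) (⊕-identityˡ 0ᵛ) ⟨
    ε c (0ᵛ ⊕ 0ᵛ)         ≡⟨ bimulʳ c 0ᵛ 0ᵛ p inL-0ᵛ inL-0ᵛ ⟩
    ε c 0ᵛ xor ε c 0ᵛ     ≡⟨ xor-same (ε c 0ᵛ) ⟩
    false                 ∎

  module _ {σ : Permutation′ N} (aut : InAut C σ) {u : Vect N → Bool}
      (lift : IsLift C ε σ u) (std : IsStandard C σ u) where

    private
      g : Vect N → Vect N
      g = ι σ

      gⁿ-⊕ : ∀ n a b → iter n g (a ⊕ b) ≡ iter n g a ⊕ iter n g b
      gⁿ-⊕ = iter-homo₂ g _⊕_ (ι-⊕ σ)

      inL-gⁿ : ∀ n {a} → inL C a → inL C (iter n g a)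
      inL-gⁿ = iter-preserves g (inL C) (inL-ι σ aut)

    sign : ℕ → Vect N → Bool
    sign zero a = false
    sign (suc n) a = sign n a xor u (iter n g a)

    iter-hatAct : ∀ n a → iter n (hatAct σ u) (false , a) ≡ (sign n a , iter n g a)
    iter-hatAct zero a = refl
    iter-hatAct (suc n) a = cong (hatAct σ u) (iter-hatAct n a)

    lift-iter : ∀ n → LiftOf (iter n g) (sign n)
    lift-iter zero = lift-id
    lift-iter (suc n) = lift-∘ {w = sign n} {v = u} (gⁿ-⊕ n) (inL-gⁿ n) (lift-iter n) lift

    sign-+ : ∀ m n a → sign (m ℕ.+ n) a ≡ sign n a xor sign m (iter n g a)
    sign-+ zero n a = sym (xor-identityʳ (sign n a))
    sign-+ (suc m) n a = begin
      sign (m ℕ.+ n) a xor u (iter (m ℕ.+ n) g a)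
        ≡⟨ cong₂ _xor_ (sign-+ m n a) (cong u (sym (iter-+ g m n a))) ⟩
      (sign n a xor sign m (iter n g a)) xor u (iter m g (iter n g a))
        ≡⟨ xor-assoc (sign n a) (sign m (iter n g a)) (u (iter m g (iter n g a))) ⟩
      sign n a xor sign (suc m) (iter n g a)
        ∎

    orbitSum : ℕ → Vect N → Vect N
    orbitSum zero a = 0ᵛ
    orbitSum (suc n) a = orbitSum n a ⊕ iter n g a

    inL-orbitSum : ∀ n {a} → inL C a → inL C (orbitSum n a)
    inL-orbitSum zero p = inL-0ᵛ
    inL-orbitSum (suc n) p = inL-⊕ (inL-orbitSum n p) (inL-gⁿ n p)

    orbitSum-suc : ∀ n a → orbitSum (suc n) a ≡ a ⊕ g (orbitSum n a)
    orbitSum-suc zero a = begin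
      0ᵛ ⊕ a      ≡⟨ ⊕-identityˡ a ⟩
      a           ≡⟨ ⊕-identityʳ a ⟨
      a ⊕ 0ᵛ      ≡⟨ cong (a ⊕_) (ι-0ᵛ σ) ⟨
      a ⊕ g 0ᵛ    ∎
    orbitSum-suc (suc n) a = begin
      orbitSum (suc n) a ⊕ iter (suc n) g a         ≡⟨ cong (_⊕ iter (suc n) g a) (orbitSum-suc n a) ⟩
      (a ⊕ g (orbitSum n a)) ⊕ g (iter n g a)       ≡⟨ ⊕-assoc a (g (orbitSum n a)) (g (iter n g a)) ⟩
      a ⊕ (g (orbitSum n a) ⊕ g (iter n g a))       ≡⟨ cong (a ⊕_) (ι-⊕ σ (orbitSum n a) (iter n g a)) ⟨
      a ⊕ g (orbitSum (suc n) a)                    ∎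

    orbitSum-fixed : ∀ n {y} → iter n g y ≡ y → g (orbitSum n y) ≡ orbitSum n y
    orbitSum-fixed n {y} gⁿy≡y = ⊕-cancelˡ y _ _ (begin
      y ⊕ g (orbitSum n y)         ≡⟨ orbitSum-suc n y ⟨
      orbitSum n y ⊕ iter n g y    ≡⟨ cong (orbitSum n y ⊕_) gⁿy≡y ⟩
      orbitSum n y ⊕ y             ≡⟨ ⊕-comm (orbitSum n y) y ⟩
      y ⊕ orbitSum n y             ∎)

    u-orbitSum : ∀ n {a} → inL C a →
      u (orbitSum n a) xor sign n a ≡ ε (orbitSum n a) (iter n g a) xor ε a (g (orbitSum n a))
    u-orbitSum zero {a} p = begin
      u 0ᵛ xor false         ≡⟨ cong (_xor false) (std 0ᵛ inL-0ᵛ (ι-0ᵛ σ)) ⟩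
      false                  ≡⟨ cong₂ _xor_ (ε-0ᵛˡ p) (trans (cong (ε a) (ι-0ᵛ σ)) (ε-0ᵛʳ p)) ⟨
      ε 0ᵛ a xor ε a (g 0ᵛ)  ∎
    u-orbitSum (suc n) {a} p = begin
      u (S ⊕ h) xor (sign n a xor u h)
        ≡⟨ solve 4 (λ x s y z → (x ⊻ (s ⊻ y)) ⊜ ((z ⊻ s) ⊻ (z ⊻ (y ⊻ x)))) refl (u (S ⊕ h)) (sign n a) (u h) (u S) ⟩
      (u S xor sign n a) xor (u S xor u h xor u (S ⊕ h))
        ≡⟨ cong₂ _xor_ (u-orbitSum n p) (sym (lift S h pS ph)) ⟩
      (ε S h xor ε a (g S)) xor (ε S h xor ε (g S) (g h))
        ≡⟨ solve 3 (λ p q r → ((p ⊻ q) ⊻ (p ⊻ r)) ⊜ (q ⊻ r)) refl (ε S h) (ε a (g S)) (ε (g S) (g h)) ⟩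
      ε a (g S) xor ε (g S) (g h)
        ≡⟨ solve 3 (λ p q r → ((p ⊻ r) ⊻ (q ⊻ p)) ⊜ (q ⊻ r)) refl (ε a (g h)) (ε a (g S)) (ε (g S) (g h)) ⟨
      (ε a (g h) xor ε (g S) (g h)) xor (ε a (g S) xor ε a (g h))
        ≡⟨ cong₂ _xor_ (bimulˡ a (g S) (g h) p (inL-ι σ aut pS) (inL-ι σ aut ph))
                       (bimulʳ a (g S) (g h) p (inL-ι σ aut pS) (inL-ι σ aut ph)) ⟨
      ε (a ⊕ g S) (g h) xor ε a (g S ⊕ g h)
        ≡⟨ cong₂ (λ x y → ε x (g h) xor ε a y) (orbitSum-suc n a) (ι-⊕ σ S h) ⟨
      ε (S ⊕ h) (g h) xor ε a (g (S ⊕ h))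
        ∎
      where
      S = orbitSum n a
      h = iter n g a
      pS = inL-orbitSum n p
      ph = inL-gⁿ n p

    sign-fixed : ∀ n {y} → inL C y → iter n g y ≡ y → sign n y ≡ pairSign (orbitSum n y) y
    sign-fixed n {y} p gⁿy≡y = begin
      sign n y                             ≡⟨ cong (_xor sign n y) (std S (inL-orbitSum n p) gS≡S) ⟨
      u S xor sign n y                     ≡⟨ u-orbitSum n p ⟩
      ε S (iter n g y) xor ε y (g S)       ≡⟨ cong₂ (λ x z → ε S x xor ε y z) gⁿy≡y gS≡S ⟩
      ε S y xor ε y S                      ≡⟨ comm S y (inL-orbitSum n p) p ⟩
      pairSign S y                         ∎
      where
      S = orbitSum n y
      gS≡S = orbitSum-fixed n gⁿy≡y

    module _ (sd : SelfDual C) where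

      sign-involution : ∀ k {a} → inL C a → iter k g (iter k g a) ≡ a →
        sign (k ℕ.+ k) a ≡ pairSign a (iter k g a)
      sign-involution k {a} pa involutive = begin
        sign (k ℕ.+ k) a                      ≡⟨ sign-+ k k a ⟩
        sign k a xor sign k h                 ≡⟨ cong (sign k a xor_) (xor-identityʳ (sign k h)) ⟨
        sign k a xor sign k h xor false       ≡⟨ cong (λ s → sign k a xor sign k h xor s) sign-y≡false ⟨
        sign k a xor sign k h xor sign k y    ≡⟨ lift-iter k a h pa ph ⟨
        ε a h xor ε h (iter k g h)            ≡⟨ cong (λ z → ε a h xor ε h z) involutive ⟩
        ε a h xor ε h a                       ≡⟨ comm a h pa ph ⟩
        pairSign a h                          ∎
        where
        h = iter k g a
        y = a ⊕ h
        ph = inL-gⁿ k pa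
        py = inL-⊕ pa ph
        gᵏy≡y : iter k g y ≡ y
        gᵏy≡y = trans (gⁿ-⊕ k a h) (trans (cong (h ⊕_) involutive) (⊕-comm h a))
        sign-y≡false : sign k y ≡ false
        sign-y≡false = trans (sign-fixed k py gᵏy≡y)
          (pairSign-trace sd σ k (inL-orbitSum k py) pa (iter-fixed g (orbitSum-fixed k gᵏy≡y) k))

      hatAct-order : ∀ k → (∀ i → pow σ (2 * k) i ≡ i) → ∀ {a} → inL C a →
        iter (2 * k) (hatAct σ u) (false , a) ≡ (pairSign a (iter k g a) , a)
      hatAct-order k σ²ᵏ≡id {a} pa = begin
        iter (2 * k) (hatAct σ u) (false , a)   ≡⟨ iter-hatAct (2 * k) a ⟩
        (sign (2 * k) a , iter (2 * k) g a)     ≡⟨ cong₂ _,_ (cong (λ m → sign m a) (2*k≡k+k k)) (iter-ι-id σ (2 * k) σ²ᵏ≡id a) ⟩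
        (sign (k ℕ.+ k) a , a)                  ≡⟨ cong (_, a) (sign-involution k pa (iter-ι-half-period σ k σ²ᵏ≡id a)) ⟩
        (pairSign a (iter k g a) , a)           ∎

      noOrderDoubling⇔ : ∀ k → (∀ i → pow σ (2 * k) i ≡ i) →
        NoOrderDoubling C σ u (2 * k) ⇔ (∀ a → inL C a → pairSign a (iter k g a) ≡ false)
      noOrderDoubling⇔ k σ²ᵏ≡id = mk⇔
        (λ noDoubling a pa → cong proj₁ (trans (sym (hatAct-order k σ²ᵏ≡id pa)) (noDoubling a pa)))
        (λ signs a pa → trans (hatAct-order k σ²ᵏ≡id pa) (cong (_, a) (signs a pa)))

-- The criterion on codewords

module _ {N : ℕ} (σ : Permutation′ N) (k : ℕ)
    (involutive : ∀ a → iter k (ι σ) (iter k (ι σ) a) ≡ a) where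

  private
    h : Vect N → Vect N
    h = iter k (ι σ)

  ip2-image-mod4 : ∀ a →
    ∃ λ z → ip2 a (h a) ≡ + inter (map odd? a) (permWord σ k (map odd? a)) + + 4 ℤ.* z
  ip2-image-mod4 a = X + Z , (begin
    ip2 a (h a)
      ≡⟨ cong₂ ip2 a≡ ha≡ ⟩
    ip2 (embed A ⊕ (w ⊕ w)) (embed A′ ⊕ (h w ⊕ h w))
      ≡⟨ ip2-expand (embed A) w (embed A′) (h w) ⟩
    ip2 (embed A) (embed A′) + ((X + Y + (Z + Z)) + (X + Y + (Z + Z)))
      ≡⟨ cong₂ (λ s y → s + ((X + y + (Z + Z)) + (X + y + (Z + Z)))) (ip2-embed A A′) (sym X≡Y) ⟩
    + inter A A′ + ((X + X + (Z + Z)) + (X + X + (Z + Z)))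
      ≡⟨ regroup (+ inter A A′) X Z ⟩
    + inter A A′ + + 4 ℤ.* (X + Z)
      ∎)
    where
    A = map odd? a
    A′ = permWord σ k A
    w = proj₁ (parity-split-vec a)
    a≡ : a ≡ embed A ⊕ (w ⊕ w)
    a≡ = proj₂ (parity-split-vec a)
    h-⊕ : ∀ b c → h (b ⊕ c) ≡ h b ⊕ h c
    h-⊕ = iter-homo₂ (ι σ) _⊕_ (ι-⊕ σ) k
    ha≡ : h a ≡ embed A′ ⊕ (h w ⊕ h w)
    ha≡ = begin
      h a                        ≡⟨ cong h a≡ ⟩
      h (embed A ⊕ (w ⊕ w))      ≡⟨ h-⊕ (embed A) (w ⊕ w) ⟩
      h (embed A) ⊕ h (w ⊕ w)    ≡⟨ cong₂ _⊕_ (iter-ι-embed σ k A) (h-⊕ w w) ⟩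
      embed A′ ⊕ (h w ⊕ h w)     ∎
    X = ip2 (embed A) (h w)
    Y = ip2 w (embed A′)
    Z = ip2 w (h w)
    X≡Y : X ≡ Y
    X≡Y = begin
      ip2 (embed A) (h w)          ≡⟨ iter-invariant₂ (ι σ) ip2 (ip2-ι σ) k (embed A) (h w) ⟨
      ip2 (h (embed A)) (h (h w))  ≡⟨ cong₂ ip2 (iter-ι-embed σ k A) (involutive w) ⟩
      ip2 (embed A′) w             ≡⟨ ip2-comm (embed A′) w ⟩
      ip2 w (embed A′)             ∎
    regroup : ∀ n X Z → n + ((X + X + (Z + Z)) + (X + X + (Z + Z))) ≡ n + + 4 ℤ.* (X + Z)
    regroup = solve-∀

  module _ {C : Code N} (lin : LinearCode C) (sd : SelfDual C) (aut : InAut C σ) where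

    open Lattice lin

    pairSign⇔inter%4≡0 :
      (∀ a → inL C a → pairSign a (h a) ≡ false) ⇔ (∀ B → C B → inter B (permWord σ k B) % 4 ≡ 0)
    pairSign⇔inter%4≡0 = mk⇔ toCodewords fromCodewords
      where
      toCodewords : (∀ a → inL C a → pairSign a (h a) ≡ false) → ∀ B → C B → inter B (permWord σ k B) % 4 ≡ 0
      toCodewords signs B cB = even∧%4≢2⇒%4≡0 (inter B B′) (Equivalence.to (sd B) cB B′ cB′) (begin
        (inter B B′ % 4 ≡ᵇ 2)              ≡⟨ cong (λ z → ∣ z ∣ % 4 ≡ᵇ 2) ip2≡inter ⟨
        pairSign (embed B) (h (embed B))   ≡⟨ signs (embed B) (inL-embed cB) ⟩
        false                              ∎)
        where
        B′ = permWord σ k B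
        ip2≡inter : ip2 (embed B) (h (embed B)) ≡ + inter B B′
        ip2≡inter = trans (cong (ip2 (embed B)) (iter-ι-embed σ k B)) (ip2-embed B B′)
        cB′ : C B′
        cB′ = subst C (trans (cong (map odd?) (iter-ι-embed σ k B)) (map-odd?-embed B′))
          (iter-preserves (ι σ) (inL C) (inL-ι σ aut) k (inL-embed cB))

      fromCodewords : (∀ B → C B → inter B (permWord σ k B) % 4 ≡ 0) → ∀ a → inL C a → pairSign a (h a) ≡ false
      fromCodewords inter%4≡0 a pa with ip2-image-mod4 a
      ... | z , ip2≡ = pairSign-false a (h a) (+ q + z) (begin
        ip2 a (h a)                    ≡⟨ ip2≡ ⟩
        + inter A A′ + + 4 ℤ.* z       ≡⟨ cong (λ n → + n + + 4 ℤ.* z) inter≡q*4 ⟩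
        + (q * 4) + + 4 ℤ.* z          ≡⟨ cong (λ t → t + + 4 ℤ.* z) (ℤP.pos-* q 4) ⟩
        + q ℤ.* + 4 + + 4 ℤ.* z        ≡⟨ factor (+ q) z ⟩
        + 4 ℤ.* (+ q + z)              ∎)
        where
        A = map odd? a
        A′ = permWord σ k A
        q = inter A A′ ℕ./ 4
        inter≡q*4 : inter A A′ ≡ q * 4
        inter≡q*4 = trans (ℕD.m≡m%n+[m/n]*n (inter A A′) 4) (cong (ℕ._+ q * 4) (inter%4≡0 A pa))
        factor : ∀ q z → q ℤ.* + 4 + + 4 ℤ.* z ≡ + 4 ℤ.* (q + z)
        factor = solve-∀

theorem8p4 : (N : ℕ) (C : Code N) → LinearCode C → SelfDual C → DoublyEven C →
    (σ : Permutation′ N) → InAut C σ → (k : ℕ) → HasOrder σ (2 * k) →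
    (ε : Vect N → Vect N → Bool) → Cocycle C ε →
    (u : Vect N → Bool) → IsLift C ε σ u → IsStandard C σ u →
    NoOrderDoubling C σ u (2 * k) ⇔ (∀ B → C B → inter B (permWord σ k B) % 4 ≡ 0)
theorem8p4 N C lin sd _ σ aut k (_ , σ²ᵏ≡id , _) ε coc u lift std = ⇔-trans
  (Lifts.noOrderDoubling⇔ lin coc aut lift std sd k σ²ᵏ≡id)
  (pairSign⇔inter%4≡0 σ k (iter-ι-half-period σ k σ²ᵏ≡id) lin sd aut)
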